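{- Let $k=2a_1a_2\cdots a_m$ with $m\ge1$ and integers $a_1,\ldots,a_m>1$ such that $2,a_1,\ldots,a_m$ are pairwise relatively prime. For integers $x$ and $y\ge1$ let $x\bmod y$ denote the unique $x'\in\{0,\ldots,y-1\}$ with $x\equiv x'\pmod y$. For each $1\le i\le m$ define $r_i(j)=-1$ if $j\bmod a_i<\frac{a_i-1}{2}$ and $r_i(j)=1$ if $j\bmod a_i\ge\frac{a_i-1}{2}$, and define $f:\{0,1,\ldots,k-1\}\to\{ -1,1\}$ by $f(j)=\prod_{i=1}^m r_i(j)$. Then: (1) the number of $j$ with $f(j)=1$ is $\frac k2+1$ and the number with $f(j)=-1$ is $\frac k2-1$; (2) for every positive divisor $d$ of $k$ and every arithmetic progression $A\subseteq\{0,1,\ldots,k-1\}$ with $\frac kd$ terms and common difference $d$, we have $\sum_{j\in A}f(j)\neq0$. -}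

module Defs where

open import Data.Nat using (ℕ; zero; suc; _+_; _*_; _∸_; _<_; _<ᵇ_; NonZero)
open import Data.Nat.DivMod using (_%_)
open import Data.Nat.Coprimality using (Coprime)
open import Data.Fin using (Fin) renaming (zero to Fz; suc to Fs)
open import Data.List using (List; length; filter; upTo; map; foldr)
open import Data.Integer as ℤ using (ℤ; 1ℤ; -1ℤ)
open import Data.Bool using (if_then_else_)
open import Relation.Binary.PropositionalEquality using (_≡_)
open import Relation.Nullary using (¬_)

prodF : (m : ℕ) → (Fin m → ℕ) → ℕ
prodF zero    a = 1
prodF (suc m) a = a Fz * prodF m (λ i → a (Fs i))

prodℤ : (m : ℕ) → (Fin m → ℤ) → ℤ
prodℤ zero    g = 1ℤ
prodℤ (suc m) g = g Fz ℤ.* prodℤ m (λ i → g (Fs i))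

-- r(a, j) = -1 if (j mod a) < (a-1)/2, and +1 otherwise.
-- The comparison x < (a-1)/2 is written as 2x < a - 1 (exact, no rounding).
r : (a : ℕ) → .{{NonZero a}} → ℕ → ℤ
r a j = if (2 * (j % a)) <ᵇ (a ∸ 1) then -1ℤ else 1ℤ

f : (m : ℕ) (a : Fin m → ℕ) → (∀ i → NonZero (a i)) → ℕ → ℤ
f m a nz j = prodℤ m (λ i → r (a i) {{nz i}} j)

countVal : (k : ℕ) → (ℕ → ℤ) → ℤ → ℕ
countVal k g v = length (filter (λ j → g j ℤ.≟ v) (upTo k))

apSum : (ℕ → ℤ) → (s d n : ℕ) → ℤ
apSum g s d n = foldr ℤ._+_ (ℤ.+ 0) (map (λ t → g (s + t * d)) (upTo n))

open import Data.Nat using (_<_; s≤s)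

>1⇒nz : ∀ {n} → 1 < n → NonZero n
>1⇒nz {suc n} _ = _

module Submission where

-- f has period P = a₁⋯aₘ. Since the aᵢ are pairwise coprime, the Chinese remainder theorem
-- splits the sum of f over one period into ∏ᵢ ∑_{j<aᵢ} rᵢ(j), and every factor is 1: an odd
-- aᵢ = 2c + 1 gives c values −1 and c + 1 values +1. So f sums to 2 over {0, …, 2P − 1},
-- which determines both counts. For a progression with q terms and difference d, dq = 2P:
-- if d is even then q divides the odd P, and an odd number of signs never sums to 0; if d is
-- odd then q = 2e with de = P, so by periodicity the second half of the progression repeats
-- the first, and the sum is twice a sum of e signs with e odd.

open import Defs
open import Data.Nat.Base as ℕ using (ℕ; zero; suc; _+_; _*_; _∸_; _<_; _≤_; NonZero; _<ᵇ_)
import Data.Nat.Properties as ℕ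
open import Data.Nat.DivMod using (_%_; _/_; m≡m%n+[m/n]*n; m%n<n; m<n⇒m%n≡m; %-remove-+ʳ)
open import Data.Nat.Divisibility
  using (_∣_; _∣?_; divides; ∣-refl; ∣-trans; ∣1⇒≡1; m∣m*n; ∣n⇒∣m*n; ∣m∣n⇒∣m+n; ∣m+n∣m⇒∣n; n∣m⇒m%n≡0)
open import Data.Nat.Coprimality as Coprimality using (Coprime; coprime-divisor)
open import Data.Nat.Primality using (euclidsLemma; prime[2])
import Data.Nat.Tactic.RingSolver as ℕ-Solver
open import Data.Integer.Base as ℤ using (ℤ; 0ℤ; 1ℤ; -1ℤ; +_; -[1+_])
import Data.Integer.Properties as ℤ
import Data.Integer.Tactic.RingSolver as ℤ-Solver
open import Data.Fin.Base using (Fin; toℕ; fromℕ<; punchOut) renaming (zero to Fz; suc to Fs)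
import Data.Fin.Properties as Fin
open import Data.Fin.Permutation using (permutation)
open import Data.List.Base using (List; []; _∷_; length; filter; upTo; applyUpTo; map; foldr)
import Data.List.Properties as List
open import Data.Bool.Base using (true; false; if_then_else_)
open import Data.Product.Base using (_×_; _,_; proj₁; proj₂; ∃-syntax)
open import Data.Sum.Base using (inj₁; inj₂)
open import Function.Base using (_∘_)
open import Function.Definitions using (Injective; StrictlySurjective)
import Algebra.Properties.CommutativeMonoid.Sum as MonoidSum
open import Relation.Nullary using (¬_; Dec; yes; no; contradiction)
open import Relation.Binary.PropositionalEquality

∑ : ℕ → (ℕ → ℤ) → ℤ
∑ zero    g = 0ℤ
∑ (suc n) g = g 0 ℤ.+ ∑ n (g ∘ suc)

infixl 10 ∑
syntax ∑ n (λ j → e) = ∑[ j < n ] e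

∑-cong< : ∀ n {g h : ℕ → ℤ} → (∀ j → j < n → g j ≡ h j) → ∑ n g ≡ ∑ n h
∑-cong< zero    eq = refl
∑-cong< (suc n) eq = cong₂ ℤ._+_ (eq 0 (ℕ.s≤s ℕ.z≤n)) (∑-cong< n (λ j j<n → eq (suc j) (ℕ.s≤s j<n)))

∑-cong : ∀ n {g h : ℕ → ℤ} → (∀ j → g j ≡ h j) → ∑ n g ≡ ∑ n h
∑-cong n eq = ∑-cong< n (λ j _ → eq j)

∑-+ : ∀ m n (g : ℕ → ℤ) → ∑ (m + n) g ≡ ∑ m g ℤ.+ ∑[ j < n ] g (m + j)
∑-+ zero    n g = sym (ℤ.+-identityˡ _)
∑-+ (suc m) n g = trans (cong (ℤ._+_ (g 0)) (∑-+ m n (g ∘ suc))) (sym (ℤ.+-assoc (g 0) _ _))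

∑-const : ∀ n c → ∑[ _ < n ] c ≡ + n ℤ.* c
∑-const zero    c = sym (ℤ.*-zeroˡ c)
∑-const (suc n) c = trans (cong (ℤ._+_ c) (∑-const n c)) (sym (ℤ.suc-* (+ n) c))

∑-distrib-+ : ∀ n (g h : ℕ → ℤ) → ∑[ j < n ] (g j ℤ.+ h j) ≡ ∑ n g ℤ.+ ∑ n h
∑-distrib-+ zero    g h = refl
∑-distrib-+ (suc n) g h =
  trans (cong (ℤ._+_ (g 0 ℤ.+ h 0)) (∑-distrib-+ n (g ∘ suc) (h ∘ suc))) (interchange (g 0) (h 0) _ _)
  where
  interchange : ∀ a b c d → (a ℤ.+ b) ℤ.+ (c ℤ.+ d) ≡ (a ℤ.+ c) ℤ.+ (b ℤ.+ d)
  interchange = ℤ-Solver.solve-∀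

*-distribˡ-∑ : ∀ n c (g : ℕ → ℤ) → c ℤ.* ∑ n g ≡ ∑[ j < n ] (c ℤ.* g j)
*-distribˡ-∑ zero    c g = ℤ.*-zeroʳ c
*-distribˡ-∑ (suc n) c g = trans (ℤ.*-distribˡ-+ c (g 0) _) (cong (ℤ._+_ (c ℤ.* g 0)) (*-distribˡ-∑ n c (g ∘ suc)))

*-distribʳ-∑ : ∀ n c (g : ℕ → ℤ) → ∑ n g ℤ.* c ≡ ∑[ j < n ] (g j ℤ.* c)
*-distribʳ-∑ n c g = trans (ℤ.*-comm (∑ n g) c)
  (trans (*-distribˡ-∑ n c g) (∑-cong n (λ j → ℤ.*-comm c (g j))))

∑-comm : ∀ m n (F : ℕ → ℕ → ℤ) → ∑[ i < m ] ∑[ j < n ] F i j ≡ ∑[ j < n ] ∑[ i < m ] F i j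
∑-comm zero    n F = trans (sym (ℤ.*-zeroʳ (+ n))) (sym (∑-const n 0ℤ))
∑-comm (suc m) n F = trans (cong (ℤ._+_ (∑ n (F 0))) (∑-comm m n (F ∘ suc))) (sym (∑-distrib-+ n (F 0) _))

∑-* : ∀ n a (g : ℕ → ℤ) → ∑ (n * a) g ≡ ∑[ t < n ] ∑[ x < a ] g (t * a + x)
∑-* zero    a g = refl
∑-* (suc n) a g = trans (∑-+ a (n * a) g) (cong (ℤ._+_ (∑ a g)) (trans (∑-* n a (λ j → g (a + j)))
  (∑-cong n (λ t → ∑-cong a (λ x → cong g (sym (ℕ.+-assoc a (t * a) x)))))))

∑-repeat : ∀ n (g : ℕ → ℤ) → (∀ j → g (n + j) ≡ g j) → ∑ (n + n) g ≡ ∑ n g ℤ.+ ∑ n g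
∑-repeat n g shift = trans (∑-+ n n g) (cong (ℤ._+_ (∑ n g)) (∑-cong n shift))

foldr-+-applyUpTo : ∀ n (g : ℕ → ℤ) (h : ℕ → ℕ) →
  foldr ℤ._+_ 0ℤ (map g (applyUpTo h n)) ≡ ∑[ j < n ] g (h j)
foldr-+-applyUpTo zero    g h = refl
foldr-+-applyUpTo (suc n) g h = cong (ℤ._+_ (g (h 0))) (foldr-+-applyUpTo n g (h ∘ suc))

module FinSum = MonoidSum ℤ.+-0-commutativeMonoid

∑≡sum : ∀ n (g : ℕ → ℤ) → ∑ n g ≡ FinSum.sum {n} (g ∘ toℕ)
∑≡sum zero    g = refl
∑≡sum (suc n) g = cong (ℤ._+_ (g 0)) (∑≡sum n (g ∘ suc))

injective⇒strictlySurjective : ∀ {n} {σ : Fin n → Fin n} → Injective _≡_ _≡_ σ → StrictlySurjective _≡_ σ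
injective⇒strictlySurjective {zero}  {σ} inj ()
injective⇒strictlySurjective {suc n} {σ} inj y with Fin.any? (λ i → σ i Fin.≟ y)
... | yes hit = hit
... | no miss = contradiction (Fin.injective⇒≤ punchOut-σ-injective) ℕ.1+n≰n
  where
  y≢σ : ∀ i → y ≢ σ i
  y≢σ i y≡σi = miss (i , sym y≡σi)
  punchOut-σ-injective : Injective _≡_ _≡_ (λ i → punchOut (y≢σ i))
  punchOut-σ-injective eq = inj (Fin.punchOut-injective (y≢σ _) (y≢σ _) eq)

sum-reindex-injective : ∀ {n} {σ : Fin n → Fin n} → Injective _≡_ _≡_ σ → (h : Fin n → ℤ) →
  FinSum.sum {n} (h ∘ σ) ≡ FinSum.sum h
sum-reindex-injective {σ = σ} inj h = sym (FinSum.sum-permute h π)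
  where
  σ⁻¹ : ∀ y → ∃[ i ] σ i ≡ y
  σ⁻¹ = injective⇒strictlySurjective inj
  π = permutation σ (proj₁ ∘ σ⁻¹) (proj₂ ∘ σ⁻¹) (λ i → inj (proj₂ (σ⁻¹ (σ i))))

Periodic : {A : Set} → ℕ → (ℕ → A) → Set
Periodic p g = ∀ j → g (j + p) ≡ g j

periodic-+-* : ∀ {A : Set} {p} {g : ℕ → A} → Periodic p g → ∀ j t → g (j + t * p) ≡ g j
periodic-+-* {g = g} per j zero    = cong g (ℕ.+-identityʳ j)
periodic-+-* {p = p} {g} per j (suc t) = begin
  g (j + (p + t * p)) ≡⟨ cong g (ℕ.+-assoc j p (t * p)) ⟨
  g (j + p + t * p)   ≡⟨ periodic-+-* per (j + p) t ⟩
  g (j + p)           ≡⟨ per j ⟩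
  g j                 ∎
  where open ≡-Reasoning

periodic-% : ∀ {A : Set} {p} {g : ℕ → A} .{{_ : NonZero p}} → Periodic p g → ∀ j → g j ≡ g (j % p)
periodic-% {p = p} {g} per j = trans (cong g (m≡m%n+[m/n]*n j p)) (periodic-+-* per (j % p) (j / p))

∑-2*-periodic : ∀ p (g : ℕ → ℤ) → Periodic p g → ∑ (2 * p) g ≡ ∑ p g ℤ.+ ∑ p g
∑-2*-periodic p g per = trans (cong (λ n → ∑ n g) (cong (_+_ p) (ℕ.+-identityʳ p)))
  (∑-repeat p g (λ j → trans (cong g (ℕ.+-comm p j)) (per j)))

m%d≡[m+n]%d⇒d∣n : ∀ m n d .{{_ : NonZero d}} → m % d ≡ (m + n) % d → d ∣ n
m%d≡[m+n]%d⇒d∣n m n d eq = ∣m+n∣m⇒∣n (divides ((m + n) / d) q*d+n≡q′*d) (divides (m / d) refl)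
  where
  open ≡-Reasoning
  q*d+n≡q′*d : m / d * d + n ≡ (m + n) / d * d
  q*d+n≡q′*d = ℕ.+-cancelˡ-≡ (m % d) _ _ (begin
    m % d + (m / d * d + n)        ≡⟨ ℕ.+-assoc (m % d) _ n ⟨
    m % d + m / d * d + n          ≡⟨ cong (_+ n) (m≡m%n+[m/n]*n m d) ⟨
    m + n                          ≡⟨ m≡m%n+[m/n]*n (m + n) d ⟩
    (m + n) % d + (m + n) / d * d  ≡⟨ cong (_+ (m + n) / d * d) eq ⟨
    m % d + (m + n) / d * d        ∎)

affine-%-injective-≤ : ∀ {a b x u v} .{{_ : NonZero b}} → Coprime b a → v < b → u ≤ v →
  (u * a + x) % b ≡ (v * a + x) % b → u ≡ v
affine-%-injective-≤ {a} {b} {x} {u} b⊥a v<b u≤v eq with w , refl ← ℕ.m≤n⇒∃[o]m+o≡n u≤v =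
  sym (trans (cong (_+_ u) w≡0) (ℕ.+-identityʳ u))
  where
  expand : ∀ u w a x → (u + w) * a + x ≡ (u * a + x) + a * w
  expand = ℕ-Solver.solve-∀
  b∣w : b ∣ w
  b∣w = coprime-divisor b⊥a (m%d≡[m+n]%d⇒d∣n (u * a + x) (a * w) b (trans eq (cong (_% b) (expand u w a x))))
  w≡0 : w ≡ 0
  w≡0 = trans (sym (m<n⇒m%n≡m (ℕ.≤-<-trans (ℕ.m≤n+m w u) v<b))) (n∣m⇒m%n≡0 w b b∣w)

affine-%-injective : ∀ {a b x u v} .{{_ : NonZero b}} → Coprime b a → u < b → v < b →
  (u * a + x) % b ≡ (v * a + x) % b → u ≡ v
affine-%-injective {u = u} {v} b⊥a u<b v<b eq with ℕ.≤-total u v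
... | inj₁ u≤v = affine-%-injective-≤ b⊥a v<b u≤v eq
... | inj₂ v≤u = sym (affine-%-injective-≤ b⊥a u<b v≤u (sym eq))

∑-affine-periodic : ∀ (H : ℕ → ℤ) a b x .{{_ : NonZero b}} → Coprime b a → Periodic b H →
  ∑[ t < b ] H (t * a + x) ≡ ∑ b H
∑-affine-periodic H a b x b⊥a per = begin
  ∑[ t < b ] H (t * a + x)                        ≡⟨ ∑-cong b (λ t → periodic-% per (t * a + x)) ⟩
  ∑[ t < b ] H ((t * a + x) % b)                  ≡⟨ ∑≡sum b _ ⟩
  FinSum.sum {b} (λ i → H ((toℕ i * a + x) % b))  ≡⟨ FinSum.sum-cong-≗ {b} (cong H ∘ sym ∘ toℕ-σ) ⟩
  FinSum.sum {b} (H ∘ toℕ ∘ σ)                    ≡⟨ sum-reindex-injective σ-injective (H ∘ toℕ) ⟩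
  FinSum.sum {b} (H ∘ toℕ)                        ≡⟨ ∑≡sum b H ⟨
  ∑ b H                                           ∎
  where
  open ≡-Reasoning
  σ : Fin b → Fin b
  σ i = fromℕ< (m%n<n (toℕ i * a + x) b)
  toℕ-σ : ∀ i → toℕ (σ i) ≡ (toℕ i * a + x) % b
  toℕ-σ i = Fin.toℕ-fromℕ< (m%n<n (toℕ i * a + x) b)
  σ-injective : Injective _≡_ _≡_ σ
  σ-injective {i} {j} σi≡σj = Fin.toℕ-injective (affine-%-injective b⊥a (Fin.toℕ<n i) (Fin.toℕ<n j)
    (trans (sym (toℕ-σ i)) (trans (cong toℕ σi≡σj) (toℕ-σ j))))

∑-*-periodic : ∀ (G H : ℕ → ℤ) a b .{{_ : NonZero b}} → Coprime a b → Periodic a G → Periodic b H →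
  ∑[ j < a * b ] (G j ℤ.* H j) ≡ ∑ a G ℤ.* ∑ b H
∑-*-periodic G H a b a⊥b perG perH = begin
  ∑[ j < a * b ] (G j ℤ.* H j)
    ≡⟨ cong (λ n → ∑[ j < n ] (G j ℤ.* H j)) (ℕ.*-comm a b) ⟩
  ∑[ j < b * a ] (G j ℤ.* H j)
    ≡⟨ ∑-* b a _ ⟩
  ∑[ t < b ] ∑[ x < a ] (G (t * a + x) ℤ.* H (t * a + x))
    ≡⟨ ∑-comm b a _ ⟩
  ∑[ x < a ] ∑[ t < b ] (G (t * a + x) ℤ.* H (t * a + x))
    ≡⟨ ∑-cong a (λ x → ∑-cong b (λ t → cong (ℤ._* H (t * a + x)) (G-const x t))) ⟩
  ∑[ x < a ] ∑[ t < b ] (G x ℤ.* H (t * a + x))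
    ≡⟨ ∑-cong a (λ x → *-distribˡ-∑ b (G x) _) ⟨
  ∑[ x < a ] (G x ℤ.* ∑[ t < b ] H (t * a + x))
    ≡⟨ ∑-cong a (λ x → cong (G x ℤ.*_) (∑-affine-periodic H a b x (Coprimality.sym a⊥b) perH)) ⟩
  ∑[ x < a ] (G x ℤ.* ∑ b H)
    ≡⟨ *-distribʳ-∑ a (∑ b H) G ⟨
  ∑ a G ℤ.* ∑ b H
    ∎
  where
  open ≡-Reasoning
  G-const : ∀ x t → G (t * a + x) ≡ G x
  G-const x t = trans (cong G (ℕ.+-comm (t * a) x)) (periodic-+-* perG x t)

data IsSign : ℤ → Set where
  plus  : IsSign 1ℤ
  minus : IsSign -1ℤ

IsSign-* : ∀ {i j} → IsSign i → IsSign j → IsSign (i ℤ.* j)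
IsSign-* plus  plus  = plus
IsSign-* plus  minus = minus
IsSign-* minus plus  = minus
IsSign-* minus minus = plus

count : (ℕ → ℤ) → ℤ → List ℕ → ℕ
count g v xs = length (filter (λ j → g j ℤ.≟ v) xs)

module _ (g : ℕ → ℤ) (sign : ∀ j → IsSign (g j)) where

  count±1≡length : ∀ xs → count g 1ℤ xs + count g -1ℤ xs ≡ length xs
  count±1≡length []       = refl
  count±1≡length (x ∷ xs) with g x | sign x
  ... | _ | plus  = cong suc (count±1≡length xs)
  ... | _ | minus = trans (ℕ.+-suc _ _) (cong suc (count±1≡length xs))

  sum+count-1≡count+1 : ∀ xs → foldr ℤ._+_ 0ℤ (map g xs) ℤ.+ + count g -1ℤ xs ≡ + count g 1ℤ xs
  sum+count-1≡count+1 []       = refl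
  sum+count-1≡count+1 (x ∷ xs) with g x | sign x
  ... | _ | plus  = trans (ℤ.+-assoc 1ℤ (foldr ℤ._+_ 0ℤ (map g xs)) (+ count g -1ℤ xs))
                          (cong (ℤ._+_ 1ℤ) (sum+count-1≡count+1 xs))
  ... | _ | minus = trans (cancel (foldr ℤ._+_ 0ℤ (map g xs)) (+ count g -1ℤ xs)) (sum+count-1≡count+1 xs)
    where
    cancel : ∀ s c → (-1ℤ ℤ.+ s) ℤ.+ (1ℤ ℤ.+ c) ≡ s ℤ.+ c
    cancel = ℤ-Solver.solve-∀

  ∑-sign-counts : ∀ n → countVal n g 1ℤ + countVal n g -1ℤ ≡ n
                      × ∑ n g ℤ.+ + countVal n g -1ℤ ≡ + countVal n g 1ℤ
  ∑-sign-counts n =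
      trans (count±1≡length (upTo n)) (List.length-upTo n)
    , trans (cong (ℤ._+ + countVal n g -1ℤ) (sym (foldr-+-applyUpTo n g (λ j → j))))
            (sum+count-1≡count+1 (upTo n))

  ∑-sign-odd≢0 : ∀ n → ¬ 2 ∣ n → ∑ n g ≢ 0ℤ
  ∑-sign-odd≢0 n 2∤n ∑≡0 = 2∤n (subst (2 ∣_) c+c≡n (divides c (double c)))
    where
    c = countVal n g -1ℤ
    counts = ∑-sign-counts n
    balanced : c ≡ countVal n g 1ℤ
    balanced = ℤ.+-injective (trans (cong (ℤ._+ + c) (sym ∑≡0)) (proj₂ counts))
    c+c≡n : c + c ≡ n
    c+c≡n = trans (cong (_+ c) balanced) (proj₁ counts)
    double : ∀ c → c + c ≡ c * 2
    double = ℕ-Solver.solve-∀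

  ∑≡2⇒counts : ∀ n → ∑ (2 * n) g ≡ + 2 →
    countVal (2 * n) g 1ℤ ≡ n + 1 × countVal (2 * n) g -1ℤ + 1 ≡ n
  ∑≡2⇒counts n ∑≡2 = c₊≡n+1 , c₋+1≡n
    where
    open ≡-Reasoning
    c₊ = countVal (2 * n) g 1ℤ
    c₋ = countVal (2 * n) g -1ℤ
    counts = ∑-sign-counts (2 * n)
    c₊≡2+c₋ : c₊ ≡ 2 + c₋
    c₊≡2+c₋ = sym (ℤ.+-injective (trans (cong (ℤ._+ + c₋) (sym ∑≡2)) (proj₂ counts)))
    rearrange : ∀ c → 2 * (c + 1) ≡ (2 + c) + c
    rearrange = ℕ-Solver.solve-∀
    c₋+1≡n : c₋ + 1 ≡ n
    c₋+1≡n = ℕ.*-cancelˡ-≡ (c₋ + 1) n 2 (begin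
      2 * (c₋ + 1)  ≡⟨ rearrange c₋ ⟩
      (2 + c₋) + c₋ ≡⟨ cong (_+ c₋) c₊≡2+c₋ ⟨
      c₊ + c₋       ≡⟨ proj₁ counts ⟩
      2 * n         ∎)
    c₊≡n+1 : c₊ ≡ n + 1
    c₊≡n+1 = begin
      c₊          ≡⟨ c₊≡2+c₋ ⟩
      2 + c₋      ≡⟨ ℕ.+-comm 2 c₋ ⟩
      c₋ + 2      ≡⟨ ℕ.+-assoc c₋ 1 1 ⟨
      c₋ + 1 + 1  ≡⟨ cong (_+ 1) c₋+1≡n ⟩
      n + 1       ∎

r-sign : ∀ a .{{_ : NonZero a}} j → IsSign (r a j)
r-sign a j with 2 * (j % a) <ᵇ (a ∸ 1)
... | true  = minus
... | false = plus

r-+-∣ : ∀ a .{{_ : NonZero a}} {n} → a ∣ n → ∀ j → r a (j + n) ≡ r a j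
r-+-∣ a a∣n j = cong (λ i → if 2 * i <ᵇ (a ∸ 1) then -1ℤ else 1ℤ) (%-remove-+ʳ j a∣n)

r≡-1ℤ : ∀ {a j} .{{_ : NonZero a}} → j < a → 2 * j < a ∸ 1 → r a j ≡ -1ℤ
r≡-1ℤ {a} {j} j<a below rewrite m<n⇒m%n≡m j<a with 2 * j <ᵇ (a ∸ 1) | ℕ.<⇒<ᵇ below
... | true | _ = refl

r≡1ℤ : ∀ {a j} .{{_ : NonZero a}} → j < a → a ∸ 1 ≤ 2 * j → r a j ≡ 1ℤ
r≡1ℤ {a} {j} j<a above rewrite m<n⇒m%n≡m j<a with 2 * j <ᵇ (a ∸ 1) | ℕ.<ᵇ⇒< (2 * j) (a ∸ 1)
... | true  | below = contradiction (below _) (ℕ.≤⇒≯ above)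
... | false | _     = refl

∑-r[1+2c]≡1 : ∀ c → ∑ (suc (2 * c)) (r (suc (2 * c))) ≡ 1ℤ
∑-r[1+2c]≡1 c = begin
  ∑ (suc (2 * c)) (r a)                       ≡⟨ cong (λ n → ∑ n (r a)) (split c) ⟩
  ∑ (c + suc c) (r a)                         ≡⟨ ∑-+ c (suc c) (r a) ⟩
  ∑ c (r a) ℤ.+ ∑[ j < suc c ] r a (c + j)    ≡⟨ cong₂ ℤ._+_ (∑-cong< c lower) (∑-cong< (suc c) upper) ⟩
  ∑[ _ < c ] -1ℤ ℤ.+ ∑[ _ < suc c ] 1ℤ        ≡⟨ cong₂ ℤ._+_ (∑-const c -1ℤ) (∑-const (suc c) 1ℤ) ⟩
  + c ℤ.* -1ℤ ℤ.+ + suc c ℤ.* 1ℤ              ≡⟨ cancel (+ c) ⟩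
  1ℤ                                          ∎
  where
  open ≡-Reasoning
  a = suc (2 * c)
  split : ∀ c → suc (2 * c) ≡ c + suc c
  split = ℕ-Solver.solve-∀
  cancel : ∀ x → x ℤ.* -1ℤ ℤ.+ (1ℤ ℤ.+ x) ℤ.* 1ℤ ≡ 1ℤ
  cancel = ℤ-Solver.solve-∀
  c≤2c : c ≤ 2 * c
  c≤2c = ℕ.m≤m+n c (c + 0)
  lower : ∀ j → j < c → r a j ≡ -1ℤ
  lower j j<c = r≡-1ℤ (ℕ.<-≤-trans j<c (ℕ.m≤n⇒m≤1+n c≤2c)) (ℕ.*-monoʳ-< 2 j<c)
  upper : ∀ j → j < suc c → r a (c + j) ≡ 1ℤ
  upper j (ℕ.s≤s j≤c) = r≡1ℤ (ℕ.s≤s (ℕ.+-monoʳ-≤ c (ℕ.≤-trans j≤c (ℕ.m≤m+n c 0)))) (ℕ.*-monoʳ-≤ 2 (ℕ.m≤m+n c j))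

¬2∣⇒∃[c]≡1+2*c : ∀ n → ¬ 2 ∣ n → ∃[ c ] n ≡ suc (2 * c)
¬2∣⇒∃[c]≡1+2*c zero          2∤n = contradiction (divides 0 refl) 2∤n
¬2∣⇒∃[c]≡1+2*c (suc zero)    2∤n = 0 , refl
¬2∣⇒∃[c]≡1+2*c (suc (suc n)) 2∤n with c , refl ← ¬2∣⇒∃[c]≡1+2*c n (2∤n ∘ ∣m∣n⇒∣m+n ∣-refl) =
  suc c , cong suc (sym (ℕ.*-suc 2 c))

∑-r≡1 : ∀ a .{{_ : NonZero a}} → ¬ 2 ∣ a → ∑ a (r a) ≡ 1ℤ
∑-r≡1 a 2∤a with c , refl ← ¬2∣⇒∃[c]≡1+2*c a 2∤a = ∑-r[1+2c]≡1 c

coprime[2,n]⇒¬2∣n : ∀ {n} → Coprime 2 n → ¬ 2 ∣ n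
coprime[2,n]⇒¬2∣n 2⊥n 2∣n = contradiction (2⊥n (∣-refl , 2∣n)) λ ()

coprime-*ʳ : ∀ {m n o} → Coprime m n → Coprime m o → Coprime m (n * o)
coprime-*ʳ {n = n} m⊥n m⊥o {d} (d∣m , d∣n*o) = m⊥o (d∣m , coprime-divisor d⊥n d∣n*o)
  where
  d⊥n : Coprime d n
  d⊥n (e∣d , e∣n) = m⊥n (∣-trans e∣d d∣m , e∣n)

coprime-prodF : ∀ {n} m (a : Fin m → ℕ) → (∀ i → Coprime n (a i)) → Coprime n (prodF m a)
coprime-prodF zero    a n⊥a (_ , d∣1) = ∣1⇒≡1 d∣1
coprime-prodF (suc m) a n⊥a = coprime-*ʳ (n⊥a Fz) (coprime-prodF m (a ∘ Fs) (n⊥a ∘ Fs))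

∣-prodF : ∀ m (a : Fin m → ℕ) i → a i ∣ prodF m a
∣-prodF (suc m) a Fz     = m∣m*n (prodF m (a ∘ Fs))
∣-prodF (suc m) a (Fs i) = ∣n⇒∣m*n (a Fz) (∣-prodF m (a ∘ Fs) i)

prodF-nonZero : ∀ m (a : Fin m → ℕ) → (∀ i → NonZero (a i)) → NonZero (prodF m a)
prodF-nonZero zero    a nz = _
prodF-nonZero (suc m) a nz = ℕ.m*n≢0 (a Fz) _ {{nz Fz}} {{prodF-nonZero m (a ∘ Fs) (nz ∘ Fs)}}

prodℤ-cong : ∀ m {g h : Fin m → ℤ} → (∀ i → g i ≡ h i) → prodℤ m g ≡ prodℤ m h
prodℤ-cong zero    eq = refl
prodℤ-cong (suc m) eq = cong₂ ℤ._*_ (eq Fz) (prodℤ-cong m (eq ∘ Fs))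

prodℤ-sign : ∀ m {g : Fin m → ℤ} → (∀ i → IsSign (g i)) → IsSign (prodℤ m g)
prodℤ-sign zero    sign = plus
prodℤ-sign (suc m) sign = IsSign-* (sign Fz) (prodℤ-sign m (sign ∘ Fs))

module _ (m : ℕ) (a : Fin m → ℕ) (nz : ∀ i → NonZero (a i)) where

  f-sign : ∀ j → IsSign (f m a nz j)
  f-sign j = prodℤ-sign m (λ i → r-sign (a i) {{nz i}} j)

  f-periodic : Periodic (prodF m a) (f m a nz)
  f-periodic j = prodℤ-cong m (λ i → r-+-∣ (a i) {{nz i}} (∣-prodF m a i) j)

∑-f≡1 : ∀ m (a : Fin m → ℕ) nz → (∀ i → Coprime 2 (a i)) → (∀ i j → i ≢ j → Coprime (a i) (a j)) →
  ∑ (prodF m a) (f m a nz) ≡ 1ℤ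
∑-f≡1 zero    a nz odd pairwise = refl
∑-f≡1 (suc m) a nz odd pairwise = begin
  ∑ (prodF (suc m) a) (f (suc m) a nz)
    ≡⟨ ∑-*-periodic (r a₀) (f m a′ nz′) a₀ (prodF m a′) a₀⊥a′ (r-+-∣ a₀ ∣-refl) (f-periodic m a′ nz′) ⟩
  ∑ a₀ (r a₀) ℤ.* ∑ (prodF m a′) (f m a′ nz′)
    ≡⟨ cong₂ ℤ._*_ (∑-r≡1 a₀ (coprime[2,n]⇒¬2∣n (odd Fz))) (∑-f≡1 m a′ nz′ (odd ∘ Fs) pairwise′) ⟩
  1ℤ
    ∎
  where
  open ≡-Reasoning
  a₀ = a Fz
  a′ = a ∘ Fs
  nz′ = nz ∘ Fs
  instance
    _ = nz Fz
    _ = prodF-nonZero m a′ nz′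
  pairwise′ : ∀ i j → i ≢ j → Coprime (a′ i) (a′ j)
  pairwise′ i j i≢j = pairwise (Fs i) (Fs j) (i≢j ∘ Fin.suc-injective)
  a₀⊥a′ : Coprime a₀ (prodF m a′)
  a₀⊥a′ = coprime-prodF m a′ (λ i → pairwise Fz (Fs i) λ ())

i+i≡0⇒i≡0 : ∀ i → i ℤ.+ i ≡ 0ℤ → i ≡ 0ℤ
i+i≡0⇒i≡0 (+ zero)   _ = refl
i+i≡0⇒i≡0 (+ suc n)  ()
i+i≡0⇒i≡0 -[1+ n ]   ()

∑-sign-repeated≢0 : ∀ (F : ℕ → ℤ) → (∀ t → IsSign (F t)) → ∀ e → ¬ 2 ∣ e → (∀ t → F (e + t) ≡ F t) →
  ∑ (e + e) F ≢ 0ℤ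
∑-sign-repeated≢0 F sign e 2∤e shift ∑≡0 =
  ∑-sign-odd≢0 F sign e 2∤e (i+i≡0⇒i≡0 (∑ e F) (trans (sym (∑-repeat e F shift)) ∑≡0))

apSum≢0 : ∀ (g : ℕ → ℤ) p → (∀ j → IsSign (g j)) → Periodic p g → ¬ 2 ∣ p →
  ∀ d q → d * q ≡ 2 * p → ∀ s → apSum g s d q ≢ 0ℤ
apSum≢0 g p sign per 2∤p d q dq≡2p s =
  subst (_≢ 0ℤ) (sym (foldr-+-applyUpTo q F (λ t → t))) (by-parity (2 ∣? d))
  where
  F : ℕ → ℤ
  F t = g (s + t * d)
  F-sign : ∀ t → IsSign (F t)
  F-sign t = sign (s + t * d)
  2∤factor : ∀ x y → y * x ≡ p → ¬ 2 ∣ x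
  2∤factor x y yx≡p 2∣x = 2∤p (subst (2 ∣_) yx≡p (∣n⇒∣m*n y 2∣x))
  by-parity : Dec (2 ∣ d) → ∑ q F ≢ 0ℤ
  by-parity (yes (divides c d≡c*2)) = ∑-sign-odd≢0 F F-sign q (2∤factor q c cq≡p)
    where
    regroup : ∀ c q → 2 * (c * q) ≡ c * 2 * q
    regroup = ℕ-Solver.solve-∀
    cq≡p : c * q ≡ p
    cq≡p = ℕ.*-cancelˡ-≡ (c * q) p 2 (trans (regroup c q) (trans (cong (_* q) (sym d≡c*2)) dq≡2p))
  by-parity (no 2∤d) with euclidsLemma d q prime[2] (subst (2 ∣_) (sym dq≡2p) (m∣m*n p))
  ... | inj₁ 2∣d                 = contradiction 2∣d 2∤d
  ... | inj₂ (divides e q≡e*2) =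
    subst (λ n → ∑ n F ≢ 0ℤ) (sym (trans q≡e*2 (double e)))
      (∑-sign-repeated≢0 F F-sign e (2∤factor e d de≡p) shift)
    where
    double : ∀ e → e * 2 ≡ e + e
    double = ℕ-Solver.solve-∀
    regroup : ∀ d e → d * (e * 2) ≡ 2 * (d * e)
    regroup = ℕ-Solver.solve-∀
    de≡p : d * e ≡ p
    de≡p = ℕ.*-cancelˡ-≡ (d * e) p 2 (trans (sym (regroup d e)) (trans (cong (d *_) (sym q≡e*2)) dq≡2p))
    shift-index : ∀ s t d e → s + (e + t) * d ≡ (s + t * d) + d * e
    shift-index = ℕ-Solver.solve-∀
    shift : ∀ t → F (e + t) ≡ F t
    shift t = trans (cong g (trans (shift-index s t d e) (cong (_+_ (s + t * d)) de≡p))) (per (s + t * d))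

lemma3p2 : (m : ℕ) → 1 ≤ m → (a : Fin m → ℕ) → (a>1 : ∀ i → 1 < a i) →
    (∀ i → Coprime 2 (a i)) → (∀ i j → i ≢ j → Coprime (a i) (a j)) →
    let nz = λ i → >1⇒nz (a>1 i) in
    let k = 2 * prodF m a in
    (countVal k (f m a nz) 1ℤ ≡ prodF m a + 1 × countVal k (f m a nz) -1ℤ + 1 ≡ prodF m a)
    × (∀ (d q : ℕ) → 1 ≤ d → d * q ≡ k → ∀ (s : ℕ) → s + (q ∸ 1) * d < k →
         apSum (f m a nz) s d q ≢ 0ℤ)
lemma3p2 m _ a a>1 odd pairwise =
    ∑≡2⇒counts (f m a nz) (f-sign m a nz) P ∑f≡2
  , λ d q _ dq≡2P s _ → apSum≢0 (f m a nz) P (f-sign m a nz) (f-periodic m a nz) 2∤P d q dq≡2P s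
  where
  nz = λ i → >1⇒nz (a>1 i)
  P = prodF m a
  ∑f≡1 : ∑ P (f m a nz) ≡ 1ℤ
  ∑f≡1 = ∑-f≡1 m a nz odd pairwise
  ∑f≡2 : ∑ (2 * P) (f m a nz) ≡ + 2
  ∑f≡2 = trans (∑-2*-periodic P (f m a nz) (f-periodic m a nz)) (cong₂ ℤ._+_ ∑f≡1 ∑f≡1)
  2∤P : ¬ 2 ∣ P
  2∤P = coprime[2,n]⇒¬2∣n (coprime-prodF m a odd)
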